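{- Let $L$ be a nonempty countable well-order. Then for every $x\in 2^\omega$: (1) $L\cdot\omega\not\cong\omega_1^x+(\omega_1^x\cdot\mathbb{Q})$; and (2) $L\cdot\omega\equiv_2\omega_1^x+(\omega_1^x\cdot\mathbb{Q})$.
   Context: Linear orders are viewed as structures in the vocabulary $\{<\}$. For linear orders $A,B$, $A\cdot B$ is the order obtained by replacing each element of $B$ by a copy of $A$ (so $L\cdot\omega$ is $\omega$ copies of $L$ in sequence, and $\omega_1^x\cdot\mathbb{Q}$ is $\mathbb{Q}$-many copies of $\omega_1^x$); $+$ is concatenation. $\omega_1^x$ is the least ordinal not computable from $x$ (the Church–Kleene ordinal relative to $x$). Back-and-forth relations: fix an enumeration $(\phi_k)$ of atomic formulas; $(\mathcal{A},\bar a)\le_0(\mathcal{B},\bar b)$ iff for each $k<|\bar a|$, $\mathcal{A}\models\phi_k(\bar a)\iff\mathcal{B}\models\phi_k(\bar b)$; for $\alpha>0$, $(\mathcal{A},\bar a)\le_\alpha(\mathcal{B},\bar b)$ iff for every $\beta<\alpha$ and every tuple $\bar d$ in $\mathcal{B}$ there is a tuple $\bar c$ in $\mathcal{A}$ with $(\mathcal{B},\bar b\bar d)\le_\beta(\mathcal{A},\bar a\bar c)$. $\mathcal{A}\equiv_2\mathcal{B}$ means $(\mathcal{A},\emptyset)\le_2(\mathcal{B},\emptyset)$ and $(\mathcal{B},\emptyset)\le_2(\mathcal{A},\emptyset)$. -}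

module Defs where

open import Level using (0ℓ)
open import Data.Nat using (ℕ; zero; suc)
import Data.Nat as N
open import Data.Bool using (Bool; true; false; T; if_then_else_)
open import Data.Fin using (Fin)
open import Data.Vec using (Vec; []; _∷_; lookup; _++_)
open import Data.Product using (Σ; Σ-syntax; ∃; _×_; _,_)
open import Data.Sum using (_⊎_; inj₁; inj₂)
open import Data.Empty using (⊥)
open import Data.Unit using (⊤)
open import Relation.Nullary using (¬_)
open import Relation.Binary.PropositionalEquality using (_≡_)
open import Relation.Binary.Structures using (IsStrictTotalOrder)
open import Induction.WellFounded using (WellFounded)
open import Function.Bundles using (_⇔_; _↔_; _↣_; Inverse)
import Data.Rational as Q

record LO : Set₁ where
  field
    Carrier : Set
    Lt      : Carrier → Carrier → Set

open LO public

IsLinear : LO → Set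
IsLinear A = IsStrictTotalOrder (_≡_ {A = Carrier A}) (Lt A)

IsWellOrder : LO → Set
IsWellOrder A = IsLinear A × WellFounded (Lt A)

NonEmpty : LO → Set
NonEmpty A = Carrier A

Countable : LO → Set
Countable A = Carrier A ↣ ℕ

_≅_ : LO → LO → Set
A ≅ B = Σ[ e ∈ (Carrier A ↔ Carrier B) ]
          (∀ a a' → (Lt A a a' ⇔ Lt B (Inverse.to e a) (Inverse.to e a')))

_+_ : LO → LO → LO
A + B = record { Carrier = Carrier A ⊎ Carrier B ; Lt = lt }
  where
  lt : Carrier A ⊎ Carrier B → Carrier A ⊎ Carrier B → Set
  lt (inj₁ a) (inj₁ a') = Lt A a a'
  lt (inj₁ a) (inj₂ b') = ⊤
  lt (inj₂ b) (inj₁ a') = ⊥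
  lt (inj₂ b) (inj₂ b') = Lt B b b'

-- A · B : each element of B replaced by a copy of A
-- (pairs (b , a), ordered lexicographically with the B-coordinate major)
_·_ : LO → LO → LO
A · B = record { Carrier = Carrier B × Carrier A ; Lt = lt }
  where
  lt : Carrier B × Carrier A → Carrier B × Carrier A → Set
  lt (b , a) (b' , a') = Lt B b b' ⊎ (b ≡ b' × Lt A a a')

ω : LO
ω = record { Carrier = ℕ ; Lt = N._<_ }

ℚ : LO
ℚ = record { Carrier = Q.ℚ ; Lt = Q._<_ }

BF₀ : (A : LO) {n : ℕ} → Vec (Carrier A) n → (B : LO) → Vec (Carrier B) n → Set
BF₀ A {n} a B b = ∀ (i j : Fin n) →
    ((lookup a i ≡ lookup a j) ⇔ (lookup b i ≡ lookup b j))
  × (Lt A (lookup a i) (lookup a j) ⇔ Lt B (lookup b i) (lookup b j))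

-- α = 1 : for β = 0
BF₁ : (A : LO) {n : ℕ} → Vec (Carrier A) n → (B : LO) → Vec (Carrier B) n → Set
BF₁ A a B b = ∀ {k} (d : Vec (Carrier B) k) →
  Σ[ c ∈ Vec (Carrier A) k ] BF₀ B (b ++ d) A (a ++ c)

-- α = 2 : for β = 0 and β = 1
BF₂ : (A : LO) {n : ℕ} → Vec (Carrier A) n → (B : LO) → Vec (Carrier B) n → Set
BF₂ A a B b =
    (∀ {k} (d : Vec (Carrier B) k) →
       Σ[ c ∈ Vec (Carrier A) k ] BF₀ B (b ++ d) A (a ++ c))
  × (∀ {k} (d : Vec (Carrier B) k) →
       Σ[ c ∈ Vec (Carrier A) k ] BF₁ B (b ++ d) A (a ++ c))

_≡₂_ : LO → LO → Set
A ≡₂ B = BF₂ A [] B [] × BF₂ B [] A []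

data Code : ℕ → Set where
  zer  : ∀ {n} → Code n
  succ : Code 1
  proj : ∀ {n} → Fin n → Code n
  orc  : Code 1
  comp : ∀ {m n} → Code m → Vec (Code n) m → Code n
  prec : ∀ {n} → Code n → Code (suc (suc n)) → Code (suc n)
  mu   : ∀ {n} → Code (suc n) → Code n

χ : Bool → ℕ
χ b = if b then 1 else 0

mutual
  data Eval (x : ℕ → Bool) : ∀ {n} → Code n → Vec ℕ n → ℕ → Set where
    ezer  : ∀ {n} {v : Vec ℕ n} → Eval x zer v 0
    esucc : ∀ {k} → Eval x succ (k ∷ []) (suc k)
    eproj : ∀ {n} {v : Vec ℕ n} (i : Fin n) → Eval x (proj i) v (lookup v i)
    eorc  : ∀ {k} → Eval x orc (k ∷ []) (χ (x k))
    ecomp : ∀ {m n} {f : Code m} {gs : Vec (Code n) m} {v ws r} →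
            EvalAll x gs v ws → Eval x f ws r → Eval x (comp f gs) v r
    eprec0 : ∀ {n} {f : Code n} {g} {v r} →
             Eval x f v r → Eval x (prec f g) (0 ∷ v) r
    eprecS : ∀ {n} {f : Code n} {g} {v k r s} →
             Eval x (prec f g) (k ∷ v) r → Eval x g (k ∷ r ∷ v) s →
             Eval x (prec f g) (suc k ∷ v) s
    emu   : ∀ {n} {f : Code (suc n)} {v m} →
            Eval x f (m ∷ v) 0 →
            (∀ k → k N.< m → Σ[ j ∈ ℕ ] Eval x f (k ∷ v) (suc j)) →
            Eval x (mu f) v m

  data EvalAll (x : ℕ → Bool) : ∀ {m n} → Vec (Code n) m → Vec ℕ n → Vec ℕ m → Set where
    []  : ∀ {n} {v : Vec ℕ n} → EvalAll x [] v []
    _∷_ : ∀ {m n} {g : Code n} {gs : Vec (Code n) m} {v r rs} →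
          Eval x g v r → EvalAll x gs v rs → EvalAll x (g ∷ gs) v (r ∷ rs)

ComputableSet : (ℕ → Bool) → (ℕ → Bool) → Set
ComputableSet x D = Σ[ e ∈ Code 1 ] (∀ n → Eval x e (n ∷ []) (χ (D n)))

ComputableRel : (ℕ → Bool) → (ℕ → ℕ → Bool) → Set
ComputableRel x R = Σ[ e ∈ Code 2 ] (∀ n m → Eval x e (n ∷ m ∷ []) (χ (R n m)))

record CompWO (x : ℕ → Bool) : Set where
  field
    dom  : ℕ → Bool
    rel  : ℕ → ℕ → Bool
    domC : ComputableSet x dom
    relC : ComputableRel x rel

  asLO : LO
  asLO = record { Carrier = Σ ℕ (λ n → T (dom n))
                ; Lt = λ p q → T (rel (Data.Product.proj₁ p) (Data.Product.proj₁ q)) }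

  field
    wellOrder : IsWellOrder asLO

open CompWO public using (asLO)

ComputableFrom : (ℕ → Bool) → LO → Set
ComputableFrom x W = Σ[ C ∈ CompWO x ] (asLO C ≅ W)

IsoToSegment : LO → (W : LO) → Carrier W → Set
IsoToSegment C W w = Σ[ f ∈ (Carrier C → Carrier W) ]
    (∀ c c' → f c ≡ f c' → c ≡ c')
  × (∀ c → Lt W (f c) w)
  × (∀ u → Lt W u w → Σ[ c ∈ Carrier C ] f c ≡ u)
  × (∀ c c' → (Lt C c c' ⇔ Lt W (f c) (f c')))

-- W (a well-order) has order type ω₁^x: the least ordinal not computable from x,
-- i.e. W itself is not computable from x, while every smaller ordinal
-- (= every proper initial segment of W) is.
IsOmega1CK : (ℕ → Bool) → LO → Set
IsOmega1CK x W =
    ¬ ComputableFrom x W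
  × (∀ w → Σ[ C ∈ CompWO x ] IsoToSegment (asLO C) W w)

-- L·ω is well-founded, while the ℚ-part of W + W·ℚ contains the descending sequence
-- (0, w) > (−1, w) > (−2, w) > …, so the two orders are not isomorphic.
--
-- Both orders start with an initial segment a₀ < a₁ < … of type ω (for W because otherwise W
-- would be finite, hence computable from x), and neither has a greatest element. Any two linear
-- orders A, B of this kind satisfy (A, ∅) ≤₂ (B, ∅). A tuple d̄ of B, whose distinct entries are
-- s₀ < … < s_{m−1}, is answered by the tuple c̄ of A that replaces each sᵢ by aᵢ. A further tuple ē
-- of A is matched by the map sending aᵢ (i < m) to sᵢ and every x ≥ aₘ to the r-th term of an
-- increasing sequence above d̄, where r is the number of entries of ē below x; this map is
-- strictly monotone on the entries of c̄ ē, which gives ≤₀.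

module Submission where

open import Defs
open import Level using (0ℓ)
open import Function using (_∘_)
open import Function.Bundles using (mk⇔; mk↔ₛ′; Inverse; Equivalence)
open import Function.Construct.Symmetry using (⇔-sym)
open import Data.Nat as ℕ using (ℕ; zero; suc; s≤s; _<ᵇ_; _∸_)
import Data.Nat.Properties as ℕₚ
open import Data.Nat.Induction using (<-wellFounded; <-rec)
open import Data.Bool using (Bool; T)
open import Data.Bool.Properties using (T-irrelevant)
open import Data.Fin as Fin using (Fin; toℕ; fromℕ<)
import Data.Fin.Properties as Finₚ
open import Data.Vec as Vec using (Vec; []; _∷_; lookup; _++_)
import Data.Vec.Properties as Vecₚ
open import Data.Vec.Membership.Propositional using () renaming (_∈_ to _∈ᵥ_)
open import Data.Vec.Membership.Propositional.Properties using () renaming (∈-lookup to ∈ᵥ-lookup)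
open import Data.Vec.Relation.Unary.Any using () renaming (here to hereᵥ; there to thereᵥ)
import Data.Vec.Relation.Unary.Any.Properties as Anyᵥₚ
import Data.Vec.Relation.Unary.All as Allᵥ
import Data.Vec.Relation.Unary.All.Properties as Allᵥₚ
open import Data.List as List using (List; length)
open import Data.List.Membership.Propositional using (_∈_)
open import Data.List.Membership.Propositional.Properties using (∈-lookup)
open import Data.List.Relation.Unary.Any using (here; there; index)
open import Data.List.Relation.Unary.Any.Properties using (lookup-index)
open import Data.List.Relation.Unary.All as All using (All)
open import Data.List.Relation.Unary.AllPairs as AllPairs using (AllPairs)
open import Data.Product using (Σ; Σ-syntax; _×_; _,_; proj₁; proj₂)
open import Data.Product.Relation.Binary.Pointwise.NonDependent using (≡×≡⇒≡; ≡⇒≡×≡)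
open import Data.Product.Relation.Binary.Lex.Strict using (×-transitive; ×-compare; ×-wellFounded)
open import Data.Sum as Sum using (_⊎_; inj₁; inj₂)
open import Data.Sum.Properties using (inj₁-injective; inj₂-injective)
open import Data.Empty using (⊥-elim)
open import Data.Unit using (⊤; tt)
open import Relation.Nullary using (¬_; yes; no)
open import Relation.Binary.Definitions using (Transitive; Trichotomous; Tri; tri<; tri≈; tri>)
open import Relation.Binary.Structures using (IsStrictTotalOrder)
open import Relation.Binary.Structures.Biased using (isStrictTotalOrderᶜ)
open import Relation.Binary.PropositionalEquality as ≡ using (_≡_; refl; sym; trans; cong; subst; subst₂; module ≡-Reasoning)
open import Induction.WellFounded using (WellFounded; Acc; acc; module Subrelation)
import Relation.Binary.Construct.On as On
open import Axiom.ExcludedMiddle using (ExcludedMiddle)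
import Data.Rational as Q
import Data.Rational.Properties as Qₚ

private
  variable
    A B : LO

module Linear {A : LO} (linA : IsLinear A) = IsStrictTotalOrder linA

linear : Transitive (Lt A) → Trichotomous _≡_ (Lt A) → IsLinear A
linear tr cmp = isStrictTotalOrderᶜ record
  { isEquivalence = ≡.isEquivalence ; trans = tr ; compare = cmp }

tri-map-≈ : ∀ {P Q Q′ R : Set} → (Q → Q′) → (Q′ → Q) → Tri P Q R → Tri P Q′ R
tri-map-≈ to from (tri< p ¬q ¬r) = tri< p (¬q ∘ from) ¬r
tri-map-≈ to from (tri≈ ¬p q ¬r) = tri≈ ¬p (to q) ¬r
tri-map-≈ to from (tri> ¬p ¬q r) = tri> ¬p (¬q ∘ from) r

ω-isLinear : IsLinear ω
ω-isLinear = ℕₚ.<-isStrictTotalOrder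

ℚ-isLinear : IsLinear ℚ
ℚ-isLinear = Qₚ.<-isStrictTotalOrder

·-isLinear : IsLinear A → IsLinear B → IsLinear (A · B)
·-isLinear {A} {B} linA linB = linear
  (×-transitive {_≈₁_ = _≡_} {_<₁_ = Lt B} {_<₂_ = Lt A}
     ≡.isEquivalence (≡.resp₂ (Lt B)) (Linear.trans linB) (Linear.trans linA))
  (λ x y → tri-map-≈ ≡×≡⇒≡ ≡⇒≡×≡
     (×-compare {_≈₁_ = _≡_} {_<₁_ = Lt B} {_≈₂_ = _≡_} {_<₂_ = Lt A}
        sym (Linear.compare linB) (Linear.compare linA) x y))

+-isLinear : IsLinear A → IsLinear B → IsLinear (A + B)
+-isLinear {A} {B} linA linB = linear (λ {x} {y} {z} → <-trans {x} {y} {z}) compare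
  where
  <-trans : Transitive (Lt (A + B))
  <-trans {inj₁ _} {inj₁ _} {inj₁ _} p q = Linear.trans linA p q
  <-trans {inj₁ _} {inj₁ _} {inj₂ _} _ _ = tt
  <-trans {inj₁ _} {inj₂ _} {inj₂ _} _ _ = tt
  <-trans {inj₂ _} {inj₂ _} {inj₂ _} p q = Linear.trans linB p q
  <-trans {inj₁ _} {inj₂ _} {inj₁ _} _ ()
  <-trans {inj₂ _} {inj₁ _} () _
  <-trans {inj₂ _} {inj₂ _} {inj₁ _} _ ()

  compare : Trichotomous _≡_ (Lt (A + B))
  compare (inj₁ x) (inj₁ y) = tri-map-≈ (cong inj₁) inj₁-injective (Linear.compare linA x y)
  compare (inj₁ x) (inj₂ y) = tri< tt (λ ()) (λ ())
  compare (inj₂ x) (inj₁ y) = tri> (λ ()) (λ ()) tt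
  compare (inj₂ x) (inj₂ y) = tri-map-≈ (cong inj₂) inj₂-injective (Linear.compare linB x y)

·-wellFounded : WellFounded (Lt A) → WellFounded (Lt B) → WellFounded (Lt (A · B))
·-wellFounded {A} {B} wfA wfB = ×-wellFounded {_<₁_ = Lt B} {_<₂_ = Lt A} wfB wfA

+-wellFounded⁻ʳ : WellFounded (Lt (A + B)) → WellFounded (Lt B)
+-wellFounded⁻ʳ = On.wellFounded inj₂

·-wellFounded⁻ʳ : Carrier A → WellFounded (Lt (A · B)) → WellFounded (Lt B)
·-wellFounded⁻ʳ {A} {B} a wf =
  Subrelation.wellFounded inj₁ (On.wellFounded (λ b → b , a) wf)

ℚ-illFounded : ¬ WellFounded Q._<_
ℚ-illFounded wf = descend Q.0ℚ (wf Q.0ℚ)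
  where
  q-1<q : ∀ q → q Q.+ Q.- Q.1ℚ Q.< q
  q-1<q q = subst (q Q.+ Q.- Q.1ℚ Q.<_) (Qₚ.+-identityʳ q)
                  (Qₚ.+-monoʳ-< q (Qₚ.negative⁻¹ (Q.- Q.1ℚ)))
  descend : ∀ q → ¬ Acc Q._<_ q
  descend q (acc rs) = descend (q Q.+ Q.- Q.1ℚ) (rs (q-1<q q))

≅-wellFounded : A ≅ B → WellFounded (Lt A) → WellFounded (Lt B)
≅-wellFounded {A} {B} (e , ≅-Lt) wfA =
  Subrelation.wellFounded <⇒<-from (On.wellFounded from wfA)
  where
  open Inverse e
  <⇒<-from : ∀ {y y′} → Lt B y y′ → Lt A (from y) (from y′)
  <⇒<-from {y} {y′} y<y′ = Equivalence.from (≅-Lt (from y) (from y′))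
    (subst₂ (Lt B) (sym (strictlyInverseˡ y)) (sym (strictlyInverseˡ y′)) y<y′)

module StrictlyMonotone {A B : LO} (linA : IsLinear A) (linB : IsLinear B)
  (f : Carrier A → Carrier B) {x y : Carrier A}
  (mono-xy : Lt A x y → Lt B (f x) (f y)) (mono-yx : Lt A y x → Lt B (f y) (f x)) where

  injective : f x ≡ f y → x ≡ y
  injective fx≡fy with Linear.compare linA x y
  ... | tri< x<y _ _ = ⊥-elim (Linear.irrefl linB fx≡fy (mono-xy x<y))
  ... | tri≈ _ x≡y _ = x≡y
  ... | tri> _ _ y<x = ⊥-elim (Linear.irrefl linB (sym fx≡fy) (mono-yx y<x))

  reflects : Lt B (f x) (f y) → Lt A x y
  reflects fx<fy with Linear.compare linA x y
  ... | tri< x<y _ _ = x<y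
  ... | tri≈ _ refl _ = ⊥-elim (Linear.irrefl linB refl fx<fy)
  ... | tri> _ _ y<x = ⊥-elim (Linear.asym linB fx<fy (mono-yx y<x))

monotone-surjection⇒≅ : IsLinear A → IsLinear B → (f : Carrier A → Carrier B) →
  (∀ {a a′} → Lt A a a′ → Lt B (f a) (f a′)) →
  (∀ b → Σ[ a ∈ Carrier A ] f a ≡ b) → A ≅ B
monotone-surjection⇒≅ linA linB f mono surj =
  mk↔ₛ′ f (proj₁ ∘ surj) (proj₂ ∘ surj) (λ a → injective mono mono (proj₂ (surj (f a)))) ,
  λ a a′ → mk⇔ mono (reflects mono mono)
  where open StrictlyMonotone linA linB f

BF₀-sym : ∀ {n} (u : Vec (Carrier A) n) (w : Vec (Carrier B) n) → BF₀ A u B w → BF₀ B w A u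
BF₀-sym _ _ u≤₀w i j = ⇔-sym (proj₁ (u≤₀w i j)) , ⇔-sym (proj₂ (u≤₀w i j))

BF₀-map : IsLinear A → IsLinear B → (h : Carrier A → Carrier B) →
  ∀ {n} (u : Vec (Carrier A) n) →
  (∀ {x y} → x ∈ᵥ u → y ∈ᵥ u → Lt A x y → Lt B (h x) (h y)) →
  BF₀ A u B (Vec.map h u)
BF₀-map linA linB h u mono i j
  rewrite Vecₚ.lookup-map i h u | Vecₚ.lookup-map j h u =
  mk⇔ (cong h) injective , mk⇔ (mono uᵢ uⱼ) reflects
  where
  uᵢ = ∈ᵥ-lookup i u
  uⱼ = ∈ᵥ-lookup j u
  open StrictlyMonotone linA linB h (mono uᵢ uⱼ) (mono uⱼ uᵢ)

module _ {A : LO} (linA : IsLinear A) (a : ℕ → Carrier A) where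

  increasing-below⇒monotone : ∀ {n} → (∀ {i} → i ℕ.< n → Lt A (a i) (a (suc i))) →
    ∀ {i j} → i ℕ.< j → j ℕ.≤ n → Lt A (a i) (a j)
  increasing-below⇒monotone inc {i} {suc j} (s≤s i≤j) j<n with ℕₚ.m≤n⇒m<n∨m≡n i≤j
  ... | inj₁ i<j = Linear.trans linA (increasing-below⇒monotone inc i<j (ℕₚ.<⇒≤ j<n)) (inc j<n)
  ... | inj₂ refl = inc j<n

  increasing⇒monotone : (∀ i → Lt A (a i) (a (suc i))) →
    ∀ {i j} → i ℕ.< j → Lt A (a i) (a j)
  increasing⇒monotone inc i<j = increasing-below⇒monotone (λ {i} _ → inc i) i<j ℕₚ.≤-refl

record IsInitialω (A : LO) (a : ℕ → Carrier A) : Set where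
  field
    increasing : ∀ n → Lt A (a n) (a (suc n))
    below      : ∀ n x → Lt A x (a n) → Σ[ j ∈ Fin n ] x ≡ a (toℕ j)

+-isInitialωˡ : ∀ {a} → IsInitialω A a → IsInitialω (A + B) (inj₁ ∘ a)
+-isInitialωˡ a-ω = record
  { increasing = increasing
  ; below = λ { n (inj₁ x) x<aₙ → let j , x≡aⱼ = below n x x<aₙ in j , cong inj₁ x≡aⱼ }
  }
  where open IsInitialω a-ω

NonMaximal : (A : LO) → Carrier A → Set
NonMaximal A x = Σ[ y ∈ Carrier A ] Lt A x y

NoMaximum : LO → Set
NoMaximum A = ∀ x → NonMaximal A x

ω-noMaximum : NoMaximum ω
ω-noMaximum n = suc n , ℕₚ.n<1+n n

ℚ-noMaximum : NoMaximum ℚ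
ℚ-noMaximum q = q Q.+ Q.1ℚ ,
  subst (Q._< q Q.+ Q.1ℚ) (Qₚ.+-identityʳ q) (Qₚ.+-monoʳ-< q (Qₚ.positive⁻¹ Q.1ℚ))

·-noMaximum : NoMaximum B → NoMaximum (A · B)
·-noMaximum noMax (b , a) = let b′ , b<b′ = noMax b in (b′ , a) , inj₁ b<b′

+-noMaximum : Carrier B → NoMaximum B → NoMaximum (A + B)
+-noMaximum b₀ noMax (inj₁ _) = inj₂ b₀ , tt
+-noMaximum b₀ noMax (inj₂ b) = let b′ , b<b′ = noMax b in inj₂ b′ , b<b′

module Rank {A : LO} (linA : IsLinear A) where
  open Linear linA using (_<?_)

  rank : ∀ {n} → Vec (Carrier A) n → Carrier A → ℕ
  rank []       x = 0
  rank (y ∷ ys) x with y <? x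
  ... | yes _ = suc (rank ys x)
  ... | no _  = rank ys x

  rank-mono : ∀ {n} (e : Vec (Carrier A) n) {x x′} → Lt A x x′ → rank e x ℕ.≤ rank e x′
  rank-mono []       x<x′ = ℕ.z≤n
  rank-mono (y ∷ ys) {x} {x′} x<x′ with y <? x | y <? x′
  ... | yes _   | yes _    = s≤s (rank-mono ys x<x′)
  ... | yes y<x | no y≮x′  = ⊥-elim (y≮x′ (Linear.trans linA y<x x<x′))
  ... | no _    | yes _    = ℕₚ.m≤n⇒m≤1+n (rank-mono ys x<x′)
  ... | no _    | no _     = rank-mono ys x<x′

  rank-strict : ∀ {n} (e : Vec (Carrier A) n) {x x′} → x ∈ᵥ e → Lt A x x′ → rank e x ℕ.< rank e x′
  rank-strict (y ∷ ys) {x′ = x′} (hereᵥ refl) y<x′ with y <? y | y <? x′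
  ... | yes y<y | _        = ⊥-elim (Linear.irrefl linA refl y<y)
  ... | no _    | yes _    = s≤s (rank-mono ys y<x′)
  ... | no _    | no y≮x′  = ⊥-elim (y≮x′ y<x′)
  rank-strict (y ∷ ys) {x} {x′} (thereᵥ x∈ys) x<x′ with y <? x | y <? x′
  ... | yes _   | yes _    = s≤s (rank-strict ys x∈ys x<x′)
  ... | yes y<x | no y≮x′  = ⊥-elim (y≮x′ (Linear.trans linA y<x x<x′))
  ... | no _    | yes _    = ℕₚ.m<n⇒m<1+n (rank-strict ys x∈ys x<x′)
  ... | no _    | no _     = rank-strict ys x∈ys x<x′

AllPairs-lookup : ∀ {X : Set} {R : X → X → Set} {xs : List X} → AllPairs R xs →
  ∀ {i j : Fin (length xs)} → i Fin.< j → R (List.lookup xs i) (List.lookup xs j)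
AllPairs-lookup (Rx AllPairs.∷ _)  {Fin.zero}  {Fin.suc j} _         = All.lookup Rx (∈-lookup j)
AllPairs-lookup (_ AllPairs.∷ Rxs) {Fin.suc i} {Fin.suc j} (s≤s i<j) = AllPairs-lookup Rxs i<j

module Sort {B : LO} (linB : IsLinear B) where

  insert : Carrier B → List (Carrier B) → List (Carrier B)
  insert y List.[]       = y List.∷ List.[]
  insert y (z List.∷ zs) with Linear.compare linB y z
  ... | tri< _ _ _ = y List.∷ z List.∷ zs
  ... | tri≈ _ _ _ = z List.∷ zs
  ... | tri> _ _ _ = z List.∷ insert y zs

  insert-All : ∀ {P : Carrier B → Set} {y} zs → P y → All P zs → All P (insert y zs)
  insert-All List.[] Py _ = Py All.∷ All.[]
  insert-All {y = y} (z List.∷ zs) Py (Pz All.∷ Pzs) with Linear.compare linB y z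
  ... | tri< _ _ _ = Py All.∷ Pz All.∷ Pzs
  ... | tri≈ _ _ _ = Pz All.∷ Pzs
  ... | tri> _ _ _ = Pz All.∷ insert-All zs Py Pzs

  insert-ascending : ∀ {y} zs → AllPairs (Lt B) zs → AllPairs (Lt B) (insert y zs)
  insert-ascending List.[] _ = All.[] AllPairs.∷ AllPairs.[]
  insert-ascending {y} (z List.∷ zs) (z<zs AllPairs.∷ zs↑) with Linear.compare linB y z
  ... | tri< y<z _ _ = (y<z All.∷ All.map (Linear.trans linB y<z) z<zs) AllPairs.∷ z<zs AllPairs.∷ zs↑
  ... | tri≈ _ _ _   = z<zs AllPairs.∷ zs↑
  ... | tri> _ _ z<y = insert-All zs z<y z<zs AllPairs.∷ insert-ascending zs zs↑

  ∈-insert : ∀ y zs → y ∈ insert y zs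
  ∈-insert y List.[] = here refl
  ∈-insert y (z List.∷ zs) with Linear.compare linB y z
  ... | tri< _ _ _   = here refl
  ... | tri≈ _ y≡z _ = here y≡z
  ... | tri> _ _ _   = there (∈-insert y zs)

  ∈-insert⁺ : ∀ {x} y zs → x ∈ zs → x ∈ insert y zs
  ∈-insert⁺ y (z List.∷ zs) x∈ with Linear.compare linB y z
  ... | tri< _ _ _ = there x∈
  ... | tri≈ _ _ _ = x∈
  ∈-insert⁺ y (z List.∷ zs) (here x≡z)  | tri> _ _ _ = here x≡z
  ∈-insert⁺ y (z List.∷ zs) (there x∈)  | tri> _ _ _ = there (∈-insert⁺ y zs x∈)

  sort : ∀ {k} → Vec (Carrier B) k → List (Carrier B)
  sort []       = List.[]
  sort (y ∷ ys) = insert y (sort ys)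

  sort-ascending : ∀ {k} (d : Vec (Carrier B) k) → AllPairs (Lt B) (sort d)
  sort-ascending []       = AllPairs.[]
  sort-ascending (y ∷ ys) = insert-ascending (sort ys) (sort-ascending ys)

  ∈-sort : ∀ {k} (d : Vec (Carrier B) k) (i : Fin k) → lookup d i ∈ sort d
  ∈-sort (y ∷ ys) Fin.zero    = ∈-insert y (sort ys)
  ∈-sort (y ∷ ys) (Fin.suc i) = ∈-insert⁺ y (sort ys) (∈-sort ys i)

module Ascending {B : LO} (linB : IsLinear B) (b₀ : Carrier B) (noMax : NoMaximum B) where

  next : Carrier B → Carrier B
  next x = proj₁ (noMax x)

  <-next : ∀ x → Lt B x (next x)
  <-next x = proj₂ (noMax x)

  upperBound : List (Carrier B) → Carrier B
  upperBound List.[]       = b₀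
  upperBound (y List.∷ ys) with Linear.compare linB y (upperBound ys)
  ... | tri< _ _ _ = upperBound ys
  ... | tri≈ _ _ _ = next y
  ... | tri> _ _ _ = next y

  <-upperBound : ∀ {x} s → x ∈ s → Lt B x (upperBound s)
  <-upperBound (y List.∷ ys) x∈s with Linear.compare linB y (upperBound ys)
  <-upperBound (y List.∷ ys) (here refl)  | tri< y<u _ _ = y<u
  <-upperBound (y List.∷ ys) (there x∈ys) | tri< _ _ _   = <-upperBound ys x∈ys
  <-upperBound (y List.∷ ys) (here refl)  | tri≈ _ _ _   = <-next y
  <-upperBound (y List.∷ ys) (there x∈ys) | tri≈ _ u≡y _ =
    Linear.trans linB (subst (Lt B _) (sym u≡y) (<-upperBound ys x∈ys)) (<-next y)
  <-upperBound (y List.∷ ys) (here refl)  | tri> _ _ _   = <-next y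
  <-upperBound (y List.∷ ys) (there x∈ys) | tri> _ _ u<y =
    Linear.trans linB (Linear.trans linB (<-upperBound ys x∈ys) u<y) (<-next y)

  ascending : List (Carrier B) → ℕ → Carrier B
  ascending s zero    = upperBound s
  ascending s (suc n) = next (ascending s n)

  <-ascending : ∀ {x} s n → x ∈ s → Lt B x (ascending s n)
  <-ascending s zero    x∈s = <-upperBound s x∈s
  <-ascending s (suc n) x∈s = Linear.trans linB (<-ascending s n x∈s) (<-next _)

  ascending-monotone : ∀ s {i j} → i ℕ.< j → Lt B (ascending s i) (ascending s j)
  ascending-monotone s = increasing⇒monotone linB (ascending s) (λ n → <-next _)

module _ {A B : LO} (linA : IsLinear A) (linB : IsLinear B)
         {a : ℕ → Carrier A} (a-ω : IsInitialω A a) (b₀ : Carrier B) (noMax : NoMaximum B) where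
  open IsInitialω a-ω
  open Rank linA
  open Sort linB
  open Ascending linB b₀ noMax
  open Linear linA using (_<?_)

  private
    a-< : ∀ {i j} → i ℕ.< j → Lt A (a i) (a j)
    a-< = increasing⇒monotone linA a increasing

    a-reflects : ∀ {i j} → Lt A (a i) (a j) → i ℕ.< j
    a-reflects = StrictlyMonotone.reflects ω-isLinear linA a a-< a-<

    a-injective : ∀ {i j} → a i ≡ a j → i ≡ j
    a-injective = StrictlyMonotone.injective ω-isLinear linA a a-< a-<

  module Answer {k} (d : Vec (Carrier B) k) where
    s : List (Carrier B)
    s = sort d

    m : ℕ
    m = length s

    position : Fin k → Fin m
    position i = index (∈-sort d i)

    c : Vec (Carrier A) k
    c = Vec.tabulate (a ∘ toℕ ∘ position)

    c-low : ∀ {x} → x ∈ᵥ c → Lt A x (a m)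
    c-low = Allᵥ.lookup (Allᵥₚ.tabulate⁺ (λ i → a-< (Finₚ.toℕ<n (position i))))

    match : ∀ {n} → Vec (Carrier A) n → Carrier A → Carrier B
    match e x with x <? a m
    ... | yes x<aₘ = List.lookup s (proj₁ (below m x x<aₘ))
    ... | no _     = ascending s (rank e x)

    match-a : ∀ {n} (e : Vec (Carrier A) n) (t : Fin m) → match e (a (toℕ t)) ≡ List.lookup s t
    match-a e t with a (toℕ t) <? a m
    ... | yes aₜ<aₘ = cong (List.lookup s)
                        (sym (Finₚ.toℕ-injective (a-injective (proj₂ (below m _ aₜ<aₘ)))))
    ... | no aₜ≮aₘ  = ⊥-elim (aₜ≮aₘ (a-< (Finₚ.toℕ<n t)))

    d≡match∘c : ∀ {n} (e : Vec (Carrier A) n) → d ≡ Vec.map (match e) c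
    d≡match∘c e = begin
      d                                                  ≡⟨ sym (Vecₚ.tabulate∘lookup d) ⟩
      Vec.tabulate (lookup d)                            ≡⟨ Vecₚ.tabulate-cong dᵢ≡ ⟩
      Vec.tabulate (match e ∘ a ∘ toℕ ∘ position)        ≡⟨ Vecₚ.tabulate-∘ (match e) _ ⟩
      Vec.map (match e) c                                ∎
      where
      open ≡-Reasoning
      dᵢ≡ : ∀ i → lookup d i ≡ match e (a (toℕ (position i)))
      dᵢ≡ i = trans (lookup-index (∈-sort d i)) (sym (match-a e (position i)))

    low-mono : ∀ {x y} (jx : Σ[ j ∈ Fin m ] x ≡ a (toℕ j)) (jy : Σ[ j ∈ Fin m ] y ≡ a (toℕ j)) →
      Lt A x y → Lt B (List.lookup s (proj₁ jx)) (List.lookup s (proj₁ jy))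
    low-mono (j , refl) (j′ , refl) aⱼ<aⱼ′ = AllPairs-lookup (sort-ascending d) (a-reflects aⱼ<aⱼ′)

    match-mono : ∀ {n} (e : Vec (Carrier A) n) {x y} → Lt A x (a m) ⊎ x ∈ᵥ e →
      Lt A x y → Lt B (match e x) (match e y)
    match-mono e {x} {y} x-low-or-∈e x<y with x <? a m | y <? a m
    ... | yes x<aₘ | yes y<aₘ = low-mono (below m x x<aₘ) (below m y y<aₘ) x<y
    ... | yes _    | no _     = <-ascending s (rank e y) (∈-lookup _)
    ... | no x≮aₘ  | yes y<aₘ = ⊥-elim (x≮aₘ (Linear.trans linA x<y y<aₘ))
    ... | no x≮aₘ  | no _ with x-low-or-∈e
    ...   | inj₁ x<aₘ = ⊥-elim (x≮aₘ x<aₘ)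
    ...   | inj₂ x∈e  = ascending-monotone s (rank-strict e x∈e x<y)

    BF₀-c : BF₀ B d A c
    BF₀-c = BF₀-sym {A} {B} c d (subst (BF₀ A c B) (sym (d≡match∘c []))
      (BF₀-map linA linB (match []) c (λ x∈c _ → match-mono [] (inj₁ (c-low x∈c)))))

    BF₀-c++e : ∀ {n} (e : Vec (Carrier A) n) → BF₀ A (c ++ e) B (d ++ Vec.map (match e) e)
    BF₀-c++e e = subst (BF₀ A (c ++ e) B) map-c++e
      (BF₀-map linA linB (match e) (c ++ e)
        (λ x∈c++e _ → match-mono e (Sum.map₁ c-low (Anyᵥₚ.++⁻ c x∈c++e))))
      where
      map-c++e : Vec.map (match e) (c ++ e) ≡ d ++ Vec.map (match e) e
      map-c++e = trans (Vecₚ.map-++ (match e) c e)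
                       (cong (_++ Vec.map (match e) e) (sym (d≡match∘c e)))

  initialω∧noMaximum⇒BF₂ : BF₂ A [] B []
  initialω∧noMaximum⇒BF₂ =
      (λ d → c d , BF₀-c d)
    , (λ d → c d , λ e → Vec.map (match d e) e , BF₀-c++e d e)
    where open Answer

module Codes (x : ℕ → Bool) where

  pred-code : Code 1
  pred-code = prec zer (proj Fin.zero)

  eval-pred : ∀ n → Eval x pred-code (n ∷ []) (ℕ.pred n)
  eval-pred zero    = eprec0 ezer
  eval-pred (suc n) = eprecS (eval-pred n) (eproj Fin.zero)

  monus-code : Code 2
  monus-code = prec (proj Fin.zero) (comp pred-code (proj (Fin.suc Fin.zero) ∷ []))

  eval-monus : ∀ n m → Eval x monus-code (n ∷ m ∷ []) (m ∸ n)
  eval-monus zero    m = eprec0 (eproj Fin.zero)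
  eval-monus (suc n) m = subst (Eval x monus-code (suc n ∷ m ∷ [])) (ℕₚ.pred[m∸n]≡m∸[1+n] m n)
    (eprecS (eval-monus n m) (ecomp (eproj (Fin.suc Fin.zero) ∷ []) (eval-pred (m ∸ n))))

  sign : ℕ → ℕ
  sign zero    = 0
  sign (suc _) = 1

  sign-code : Code 1
  sign-code = prec zer (comp succ (zer ∷ []))

  eval-sign : ∀ n → Eval x sign-code (n ∷ []) (sign n)
  eval-sign zero    = eprec0 ezer
  eval-sign (suc n) = eprecS (eval-sign n) (ecomp (ezer ∷ []) esucc)

  sign[m∸n]≡χ[n<ᵇm] : ∀ n m → sign (m ∸ n) ≡ χ (n <ᵇ m)
  sign[m∸n]≡χ[n<ᵇm] zero    zero    = refl
  sign[m∸n]≡χ[n<ᵇm] zero    (suc m) = refl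
  sign[m∸n]≡χ[n<ᵇm] (suc n) zero    = refl
  sign[m∸n]≡χ[n<ᵇm] (suc n) (suc m) = sign[m∸n]≡χ[n<ᵇm] n m

  less-code : Code 2
  less-code = comp sign-code (monus-code ∷ [])

  eval-less : ∀ n m → Eval x less-code (n ∷ m ∷ []) (χ (n <ᵇ m))
  eval-less n m = subst (Eval x less-code (n ∷ m ∷ [])) (sign[m∸n]≡χ[n<ᵇm] n m)
    (ecomp (eval-monus n m ∷ []) (eval-sign (m ∸ n)))

  const-code : ℕ → Code 1
  const-code zero    = zer
  const-code (suc k) = comp succ (const-code k ∷ [])

  eval-const : ∀ k n → Eval x (const-code k) (n ∷ []) k
  eval-const zero    n = ezer
  eval-const (suc k) n = ecomp (eval-const k n ∷ []) esucc

  less-than-code : ℕ → Code 1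
  less-than-code k = comp less-code (proj Fin.zero ∷ const-code k ∷ [])

  eval-less-than : ∀ k n → Eval x (less-than-code k) (n ∷ []) (χ (n <ᵇ k))
  eval-less-than k n = ecomp (eproj Fin.zero ∷ eval-const k n ∷ []) (eval-less n k)

ℕ-below : ℕ → LO
ℕ-below k = record
  { Carrier = Σ ℕ (λ n → T (n <ᵇ k))
  ; Lt      = λ p q → T (proj₁ p <ᵇ proj₁ q) }

ℕ-below-isLinear : ∀ k → IsLinear (ℕ-below k)
ℕ-below-isLinear k = linear
  (λ {p} {q} {r} p<q q<r → ℕₚ.<⇒<ᵇ {proj₁ p} {proj₁ r}
    (ℕₚ.<-trans (<ᵇ⇒< {p} {q} p<q) (<ᵇ⇒< {q} {r} q<r)))
  compare
  where
  <ᵇ⇒< : ∀ {p q : Carrier (ℕ-below k)} → Lt (ℕ-below k) p q → proj₁ p ℕ.< proj₁ q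
  <ᵇ⇒< {p} {q} = ℕₚ.<ᵇ⇒< (proj₁ p) (proj₁ q)

  compare : Trichotomous _≡_ (Lt (ℕ-below k))
  compare (n , n<k) (n′ , n′<k) = tri-map-≈ ≡-below (cong proj₁) (tri-map-< (ℕₚ.<-cmp n n′))
    where
    ≡-below : n ≡ n′ → (n , n<k) ≡ (n′ , n′<k)
    ≡-below refl = cong (n ,_) (T-irrelevant n<k n′<k)
    tri-map-< : Tri (n ℕ.< n′) (n ≡ n′) (n′ ℕ.< n) → Tri (T (n <ᵇ n′)) (n ≡ n′) (T (n′ <ᵇ n))
    tri-map-< (tri< l ¬e ¬r) = tri< (ℕₚ.<⇒<ᵇ l) ¬e (¬r ∘ ℕₚ.<ᵇ⇒< n′ n)
    tri-map-< (tri≈ ¬l e ¬r) = tri≈ (¬l ∘ ℕₚ.<ᵇ⇒< n n′) e (¬r ∘ ℕₚ.<ᵇ⇒< n′ n)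
    tri-map-< (tri> ¬l ¬e r) = tri> (¬l ∘ ℕₚ.<ᵇ⇒< n n′) ¬e (ℕₚ.<⇒<ᵇ r)

ℕ-below-wellFounded : ∀ k → WellFounded (Lt (ℕ-below k))
ℕ-below-wellFounded k = Subrelation.wellFounded (λ {p} {q} → ℕₚ.<ᵇ⇒< (proj₁ p) (proj₁ q))
  (On.wellFounded proj₁ <-wellFounded)

ℕ-below-CompWO : ∀ x → ℕ → CompWO x
ℕ-below-CompWO x k = record
  { dom       = _<ᵇ k
  ; rel       = _<ᵇ_
  ; domC      = less-than-code k , eval-less-than k
  ; relC      = less-code , eval-less
  ; wellOrder = ℕ-below-isLinear k , ℕ-below-wellFounded k }
  where open Codes x

Fin-enumeration⇒computable : ∀ {x W k} → IsLinear W → (g : Fin k → Carrier W) →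
  (∀ {i j} → i Fin.< j → Lt W (g i) (g j)) → (∀ w → Σ[ i ∈ Fin k ] g i ≡ w) →
  ComputableFrom x W
Fin-enumeration⇒computable {x} {W} {k} linW g g-mono g-surj =
  ℕ-below-CompWO x k , monotone-surjection⇒≅ {ℕ-below k} {W} (ℕ-below-isLinear k) linW f (λ {p} {q} → f-mono {p} {q}) f-surj
  where
  toFin : Carrier (ℕ-below k) → Fin k
  toFin (n , n<k) = fromℕ< (ℕₚ.<ᵇ⇒< n k n<k)

  f : Carrier (ℕ-below k) → Carrier W
  f = g ∘ toFin

  f-mono : ∀ {p q} → Lt (ℕ-below k) p q → Lt W (f p) (f q)
  f-mono {n , _} {n′ , _} n<n′ = g-mono (subst₂ ℕ._<_
    (sym (Finₚ.toℕ-fromℕ< _)) (sym (Finₚ.toℕ-fromℕ< _)) (ℕₚ.<ᵇ⇒< n n′ n<n′))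

  f-surj : ∀ w → Σ[ p ∈ Carrier (ℕ-below k) ] f p ≡ w
  f-surj w = let i , gᵢ≡w = g-surj w in
    (toℕ i , ℕₚ.<⇒<ᵇ (Finₚ.toℕ<n i)) , trans (cong g (Finₚ.fromℕ<-toℕ i (Finₚ.toℕ<n i))) gᵢ≡w

module Enumeration (em : ExcludedMiddle 0ℓ) {A : LO} (linA : IsLinear A) (wfA : WellFounded (Lt A)) where

  minimal : (P : Carrier A → Set) → ∀ {x} → P x →
    Σ[ m ∈ Carrier A ] P m × (∀ {y} → P y → ¬ Lt A y m)
  minimal P {x} Px = go (wfA x) Px
    where
    go : ∀ {x} → Acc (Lt A) x → P x → Σ[ m ∈ Carrier A ] P m × (∀ {y} → P y → ¬ Lt A y m)
    go {x} (acc rs) Px with em {Σ[ y ∈ Carrier A ] P y × Lt A y x}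
    ... | yes (y , Py , y<x) = go (rs y<x) Py
    ... | no ∄y               = x , Px , λ Py y<x → ∄y (_ , Py , y<x)

  -- Junk value x when x is maximal.
  next : Carrier A → Carrier A
  next x with em {NonMaximal A x}
  ... | yes (_ , x<y) = proj₁ (minimal (Lt A x) x<y)
  ... | no _          = x

  <-next : ∀ {x} → NonMaximal A x → Lt A x (next x)
  <-next {x} nm with em {NonMaximal A x}
  ... | yes (_ , x<y) = proj₁ (proj₂ (minimal (Lt A x) x<y))
  ... | no ¬nm        = ⊥-elim (¬nm nm)

  <-next⇒≤ : ∀ {x y} → NonMaximal A x → Lt A y (next x) → Lt A y x ⊎ y ≡ x
  <-next⇒≤ {x} {y} nm y<next with em {NonMaximal A x}
  ... | no ¬nm = ⊥-elim (¬nm nm)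
  ... | yes (_ , x<z) with Linear.compare linA y x
  ...   | tri< y<x _ _ = inj₁ y<x
  ...   | tri≈ _ y≡x _ = inj₂ y≡x
  ...   | tri> _ _ x<y = ⊥-elim (proj₂ (proj₂ (minimal (Lt A x) x<z)) x<y y<next)

  module _ (a₀ : Carrier A) where

    least : Σ[ m ∈ Carrier A ] ⊤ × (∀ {y} → ⊤ → ¬ Lt A y m)
    least = minimal (λ _ → ⊤) {a₀} tt

    enum : ℕ → Carrier A
    enum zero    = proj₁ least
    enum (suc n) = next (enum n)

    NonMaximalBelow : ℕ → Set
    NonMaximalBelow n = ∀ {i} → i ℕ.< n → NonMaximal A (enum i)

    below-enum : ∀ {n x} → NonMaximalBelow n → Lt A x (enum n) → Σ[ j ∈ Fin n ] x ≡ enum (toℕ j)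
    ≤-enum : ∀ {n x} → NonMaximalBelow n → Lt A x (enum n) ⊎ x ≡ enum n →
      Σ[ j ∈ Fin (suc n) ] x ≡ enum (toℕ j)

    below-enum {zero}  _  x<e₀ = ⊥-elim (proj₂ (proj₂ least) tt x<e₀)
    below-enum {suc n} nm x<eₙ₊₁ =
      ≤-enum (λ i<n → nm (ℕₚ.m<n⇒m<1+n i<n)) (<-next⇒≤ (nm (ℕₚ.n<1+n n)) x<eₙ₊₁)

    ≤-enum nm (inj₁ x<eₙ) = let j , x≡eⱼ = below-enum nm x<eₙ in
      Fin.inject₁ j , trans x≡eⱼ (cong enum (sym (Finₚ.toℕ-inject₁ j)))
    ≤-enum {n} nm (inj₂ x≡eₙ) = Fin.fromℕ n , trans x≡eₙ (cong enum (sym (Finₚ.toℕ-fromℕ n)))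

    enum-isInitialω : (∀ n → NonMaximal A (enum n)) → IsInitialω A enum
    enum-isInitialω nm = record
      { increasing = λ n → <-next (nm n)
      ; below      = λ n x → below-enum (λ {i} _ → nm i) }

    enum-finite⇒computable : ∀ {x n} → NonMaximalBelow n → ¬ NonMaximal A (enum n) →
      ComputableFrom x A
    enum-finite⇒computable {n = n} nm eₙ-maximal =
      Fin-enumeration⇒computable linA (enum ∘ toℕ) mono surj
      where
      mono : ∀ {i j : Fin (suc n)} → i Fin.< j → Lt A (enum (toℕ i)) (enum (toℕ j))
      mono {j = j} = λ i<j → increasing-below⇒monotone linA enum (<-next ∘ nm) i<j
        (ℕₚ.≤-pred (Finₚ.toℕ<n j))

      surj : ∀ w → Σ[ j ∈ Fin (suc n) ] enum (toℕ j) ≡ w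
      surj w with Linear.compare linA w (enum n)
      ... | tri< w<eₙ _ _ = let j , w≡eⱼ = ≤-enum nm (inj₁ w<eₙ) in j , sym w≡eⱼ
      ... | tri≈ _ w≡eₙ _ = let j , w≡eⱼ = ≤-enum nm (inj₂ w≡eₙ) in j , sym w≡eⱼ
      ... | tri> _ _ eₙ<w = ⊥-elim (eₙ-maximal (w , eₙ<w))

noMaximum⇒initialω : ExcludedMiddle 0ℓ → IsWellOrder A → Carrier A → NoMaximum A →
  Σ[ a ∈ (ℕ → Carrier A) ] IsInitialω A a
noMaximum⇒initialω em (linA , wfA) a₀ noMax = enum a₀ , enum-isInitialω a₀ (noMax ∘ enum a₀)
  where open Enumeration em linA wfA

incomputable⇒initialω : ∀ {x} → ExcludedMiddle 0ℓ → IsWellOrder A → ¬ ComputableFrom x A →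
  Σ[ a ∈ (ℕ → Carrier A) ] IsInitialω A a
incomputable⇒initialω {A} em (linA , wfA) incomputable with em {Carrier A}
... | no ∄a  = ⊥-elim (incomputable
        (Fin-enumeration⇒computable {k = 0} linA (λ ()) (λ { {()} }) (λ a → ⊥-elim (∄a a))))
... | yes a₀ = enum a₀ , enum-isInitialω a₀ (<-rec _ nonMaximal)
  where
  open Enumeration em linA wfA
  nonMaximal : ∀ n → NonMaximalBelow a₀ n → NonMaximal A (enum a₀ n)
  nonMaximal n nm with em {NonMaximal A (enum a₀ n)}
  ... | yes eₙ-nonMaximal = eₙ-nonMaximal
  ... | no eₙ-maximal     = ⊥-elim (incomputable (enum-finite⇒computable a₀ nm eₙ-maximal))

lemma4p5 : ExcludedMiddle 0ℓ →
    (L : LO) → IsWellOrder L → NonEmpty L → Countable L →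
    (x : ℕ → Bool) →
    (W : LO) → IsWellOrder W → IsOmega1CK x W →
    (¬ ((L · ω) ≅ (W + (W · ℚ)))) × ((L · ω) ≡₂ (W + (W · ℚ)))
lemma4p5 em L (linL , wfL) l₀ _ x W (linW , wfW) (W-incomputable , _) =
  L·ω≇W+W·ℚ , initialω∧noMaximum⇒BF₂ L·ω-linear W+W·ℚ-linear (proj₂ L·ω-initial) (inj₁ w₀) W+W·ℚ-noMaximum
            , initialω∧noMaximum⇒BF₂ W+W·ℚ-linear L·ω-linear (+-isInitialωˡ (proj₂ W-initial)) (0 , l₀) L·ω-noMaximum
  where
  L·ω-linear : IsLinear (L · ω)
  L·ω-linear = ·-isLinear linL ω-isLinear

  L·ω-wellFounded : WellFounded (Lt (L · ω))
  L·ω-wellFounded = ·-wellFounded {L} {ω} wfL <-wellFounded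

  W+W·ℚ-linear : IsLinear (W + (W · ℚ))
  W+W·ℚ-linear = +-isLinear linW (·-isLinear linW ℚ-isLinear)

  W-initial : Σ[ a ∈ (ℕ → Carrier W) ] IsInitialω W a
  W-initial = incomputable⇒initialω em (linW , wfW) W-incomputable

  w₀ : Carrier W
  w₀ = proj₁ W-initial 0

  L·ω-noMaximum : NoMaximum (L · ω)
  L·ω-noMaximum = ·-noMaximum ω-noMaximum

  W+W·ℚ-noMaximum : NoMaximum (W + (W · ℚ))
  W+W·ℚ-noMaximum = +-noMaximum (Q.0ℚ , w₀) (·-noMaximum ℚ-noMaximum)

  L·ω-initial : Σ[ a ∈ (ℕ → Carrier (L · ω)) ] IsInitialω (L · ω) a
  L·ω-initial = noMaximum⇒initialω em (L·ω-linear , L·ω-wellFounded) (0 , l₀) L·ω-noMaximum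

  L·ω≇W+W·ℚ : ¬ ((L · ω) ≅ (W + (W · ℚ)))
  L·ω≇W+W·ℚ iso = ℚ-illFounded
    (·-wellFounded⁻ʳ w₀ (+-wellFounded⁻ʳ {W} (≅-wellFounded iso L·ω-wellFounded)))
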